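{- Let $k\ge 4$ and let $G_k$ be the graph defined below (for $\ell=2$). Then $G_k$ has no edge from node $0$ to any node of $\{III_b^k,\ldots,II_t^k\}$ (the nonzero nodes of $B_2\cup B_3$), and exactly one edge from node $0$ to a node of $\{IV_b^k,\ldots,IV_t^k\}$ (the nonzero nodes of $B_4$), namely the edge to $IV_b^k$.
   Context: The pruning function $\operatorname{P}_{2}:\mathbb{Z}_{>0}\to\mathbb{Z}_{\geq 0}$: write $m$ in binary, padded on the left with zeros as needed, let $z$ be the position (position $0$ = least significant bit) of the second zero bit counted from the right, let $q = 2^{z}\lfloor m/2^{z}\rfloor$, and set $\operatorname{P}_2(m)=\max(q-1,0)$. For an integer $k\ge 2$, $G_k$ is the directed graph with node set $\{0\}\cup\{2^{k-1}-1,\ldots,2^k-1\}$ and edges: for each $m$ with $2^{k-1}-1\le m<2^k-1$, a "blue" edge from $m$ to $m+1$ (weight $-1$) and a "red" edge from $\operatorname{P}_2(m)$ to $m$ (weight $+1$). For $k\ge 4$ set $I_t^k=2^k-1$, $I_b^k=2^k-2^{k-2}-1$, $II_t^k=2^k-2^{k-2}-2$, $II_b^k=2^k-2^{k-2}-2^{k-4}-1$, $III_t^k=2^k-2^{k-2}-2^{k-4}-2$, $III_b^k=2^k-2^{k-2}-2^{k-3}-1$, $IV_t^k=2^k-2^{k-2}-2^{k-3}-2$, $IV_b^k=2^{k-1}-1$. For $X\in\{I,II,III,IV\}$, the box $B_j$ ($j=1,2,3,4$ respectively) of $G_k$ is the induced subgraph of $G_k$ on $\{0\}\cup\{X_b^k,\ldots,X_t^k\}$.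 -}

module Defs where

open import Data.Nat using (ℕ; zero; suc; _+_; _*_; _∸_; _^_; _≤_; _<_)
open import Data.Nat.DivMod using (_/_; _%_)
open import Data.Nat using (NonZero)
open import Data.Nat.Properties using (_≟_; m^n≢0)
open import Relation.Nullary using (yes; no)

-- Number of trailing one bits of m, computed with fuel.
-- (Fuel f ≥ number of trailing ones suffices; fuel m always suffices.)
trailingOnes : ℕ → ℕ → ℕ
trailingOnes zero    m = 0
trailingOnes (suc f) m with m % 2 ≟ 1
... | yes _ = suc (trailingOnes f (m / 2))
... | no  _ = 0

-- Position (0 = least significant bit) of the second zero bit of m,
-- counted from the right (m padded on the left with zeros).
-- First zero is at position t = trailingOnes m; the second zero is at
-- t + 1 + (number of trailing ones of ⌊m / 2^(t+1)⌋).
secondZeroPos : ℕ → ℕ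
secondZeroPos m = t + 1 + trailingOnes m ((m / 2 ^ (t + 1)) {{m^n≢0 2 (t + 1)}})
  where t = trailingOnes m m

P₂ : ℕ → ℕ
P₂ m = (2 ^ z * ((m / 2 ^ z) {{m^n≢0 2 z}})) ∸ 1
  where z = secondZeroPos m

-- Edges of G_k (as a multigraph: each edge is a separate inhabitant).
-- For 2^(k-1) - 1 ≤ m < 2^k - 1: a blue edge m → m+1 and a red edge P₂(m) → m.
data Edge (k : ℕ) : ℕ → ℕ → Set where
  blue : (m : ℕ) → 2 ^ (k ∸ 1) ∸ 1 ≤ m → m < 2 ^ k ∸ 1 → Edge k m (suc m)
  red  : (m : ℕ) → 2 ^ (k ∸ 1) ∸ 1 ≤ m → m < 2 ^ k ∸ 1 → Edge k (P₂ m) m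

IIₜ : ℕ → ℕ
IIₜ k = 2 ^ k ∸ 2 ^ (k ∸ 2) ∸ 2

IIIᵦ : ℕ → ℕ
IIIᵦ k = 2 ^ k ∸ 2 ^ (k ∸ 2) ∸ 2 ^ (k ∸ 3) ∸ 1

IVₜ : ℕ → ℕ
IVₜ k = 2 ^ k ∸ 2 ^ (k ∸ 2) ∸ 2 ^ (k ∸ 3) ∸ 2

IVᵦ : ℕ → ℕ
IVᵦ k = 2 ^ (k ∸ 1) ∸ 1

{-# OPTIONS --safe #-}
-- Writing m + 1 = 2ᵗ(1 + 2q) and q + 1 = 2ˢ(1 + 2q′) exposes the two lowest zero bits of m, at
-- positions t and z = t + 1 + s, and then P₂ m = 2ᶻ · 2q′ ∸ 1. So P₂ m = 0 forces q′ = 0, i.e.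
-- m + 1 + 2ᵗ = 2ᶻ with t < z. Every edge leaving 0 is red, so its target m has this form; if also
-- IVᵦ ≤ m ≤ IIₜ then 2ᵏ⁻¹ ≤ m + 1 < 3·2ᵏ⁻², which pins z = k and t = k − 1, hence m = IVᵦ.
-- Conversely IVᵦ = 2ᵏ⁻¹ − 1 is all ones, so q = q′ = 0 and its red edge starts at 0; that edge is
-- the only one because ≤, < and ≡ on ℕ are proof-irrelevant.
module Submission where

open import Defs
open import Data.Nat
open import Data.Nat.Properties
open import Data.Nat.DivMod
open import Data.Nat.Divisibility using (divides-refl)
open import Data.Nat.Tactic.RingSolver using (solve-∀)
open import Data.Product using (_×_; _,_; proj₁; proj₂; ∃-syntax; ∃₂)
open import Function using (_∘_)
open import Relation.Nullary using (¬_; yes; no; contradiction)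
open import Relation.Binary.PropositionalEquality

^-cancelʳ-< : ∀ m .{{_ : NonZero m}} {a b} → m ^ a < m ^ b → a < b
^-cancelʳ-< m mᵃ<mᵇ = ≰⇒> (<⇒≱ mᵃ<mᵇ ∘ ^-monoʳ-≤ m)

2^m≡2^n*[1+2q]⇒q≡0 : ∀ m n q → 2 ^ m ≡ 2 ^ n * (1 + 2 * q) → q ≡ 0
2^m≡2^n*[1+2q]⇒q≡0 zero    zero    zero    _ = refl
2^m≡2^n*[1+2q]⇒q≡0 zero    zero    (suc q) ()
2^m≡2^n*[1+2q]⇒q≡0 (suc m) zero    q eq =
  contradiction (trans eq (+-identityʳ (1 + 2 * q))) (even≢odd (2 ^ m) q)
2^m≡2^n*[1+2q]⇒q≡0 zero    (suc n) q eq =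
  contradiction (sym (trans eq (*-assoc 2 (2 ^ n) _))) (even≢odd (2 ^ n * (1 + 2 * q)) 0)
2^m≡2^n*[1+2q]⇒q≡0 (suc m) (suc n) q eq =
  2^m≡2^n*[1+2q]⇒q≡0 m n q (*-cancelˡ-≡ _ _ 2 (trans eq (*-assoc 2 (2 ^ n) _)))

m+r≡[1+q]*d⇒m/d≡q : ∀ {m r d q} .{{_ : NonZero d}} → 0 < r → r ≤ d → m + r ≡ suc q * d → m / d ≡ q
m+r≡[1+q]*d⇒m/d≡q {m} {r} {d} {q} 0<r r≤d eq = begin
  m                 / d  ≡⟨ /-congˡ m≡[d∸r]+q*d ⟩
  (d ∸ r + q * d)   / d  ≡⟨ +-distrib-/-∣ʳ (d ∸ r) (divides-refl q) ⟩
  (d ∸ r) / d + q * d / d ≡⟨ cong₂ _+_ (m<n⇒m/n≡0 (∸-monoʳ-< 0<r r≤d)) (m*n/n≡m q d) ⟩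
  q                      ∎
  where
  open ≡-Reasoning
  m≡[d∸r]+q*d : m ≡ d ∸ r + q * d
  m≡[d∸r]+q*d = +-cancelʳ-≡ r m (d ∸ r + q * d) (begin
    m + r                 ≡⟨ eq ⟩
    d + q * d             ≡⟨ cong (_+ q * d) (m∸n+n≡m r≤d) ⟨
    d ∸ r + r + q * d     ≡⟨ +-assoc (d ∸ r) r (q * d) ⟩
    d ∸ r + (r + q * d)   ≡⟨ cong (d ∸ r +_) (+-comm r (q * d)) ⟩
    d ∸ r + (q * d + r)   ≡⟨ +-assoc (d ∸ r) (q * d) r ⟨
    d ∸ r + q * d + r     ∎)

odd⇒≡1+[m/2]*2 : ∀ m → m % 2 ≡ 1 → m ≡ 1 + m / 2 * 2
odd⇒≡1+[m/2]*2 m m%2≡1 = trans (m≡m%n+[m/n]*n m 2) (cong (_+ m / 2 * 2) m%2≡1)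

¬odd⇒≡[m/2]*2 : ∀ m → m % 2 ≢ 1 → m ≡ m / 2 * 2
¬odd⇒≡[m/2]*2 m m%2≢1 with m % 2 | m%n<n m 2 | m≡m%n+[m/n]*n m 2
... | 0 | _               | m≡[m/2]*2 = m≡[m/2]*2
... | 1 | _               | _         = contradiction refl m%2≢1
... | suc (suc _) | s≤s (s≤s ()) | _

trailingOnes-spec : ∀ f m → m ≤ f → ∃[ q ] m + 1 ≡ 2 ^ trailingOnes f m * (1 + 2 * q)
trailingOnes-spec zero    zero _ = 0 , refl
trailingOnes-spec (suc f) m m≤1+f with m % 2 ≟ 1
... | no  m%2≢1 = m / 2 , (begin
  m + 1             ≡⟨ cong (_+ 1) (¬odd⇒≡[m/2]*2 m m%2≢1) ⟩
  m / 2 * 2 + 1     ≡⟨ shift (m / 2) ⟩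
  1 * (1 + 2 * (m / 2)) ∎)
  where
  open ≡-Reasoning
  shift : ∀ h → h * 2 + 1 ≡ 1 * (1 + 2 * h)
  shift = solve-∀
... | yes m%2≡1 = q , (begin
  m + 1                           ≡⟨ cong (_+ 1) m≡1+h*2 ⟩
  1 + h * 2 + 1                   ≡⟨ carry h ⟩
  2 * (h + 1)                     ≡⟨ cong (2 *_) h+1≡ ⟩
  2 * (2 ^ t * (1 + 2 * q))       ≡⟨ *-assoc 2 (2 ^ t) _ ⟨
  2 ^ suc t * (1 + 2 * q)         ∎)
  where
  open ≡-Reasoning
  h = m / 2
  t = trailingOnes f h
  m≡1+h*2 : m ≡ 1 + h * 2
  m≡1+h*2 = odd⇒≡1+[m/2]*2 m m%2≡1
  h≤f : h ≤ f
  h≤f = ≤-trans (m≤m*n h 2) (s≤s⁻¹ (subst (_≤ suc f) m≡1+h*2 m≤1+f))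
  ih = trailingOnes-spec f h h≤f
  q = proj₁ ih
  h+1≡ = proj₂ ih
  carry : ∀ h → 1 + h * 2 + 1 ≡ 2 * (h + 1)
  carry = solve-∀

m+1+2^t≡[1+q]*2^z⇒m/2^z≡q : ∀ {m} t z q → t < z → m + (1 + 2 ^ t) ≡ suc q * 2 ^ z →
                            (m / 2 ^ z) {{m^n≢0 2 z}} ≡ q
m+1+2^t≡[1+q]*2^z⇒m/2^z≡q t z q t<z =
  m+r≡[1+q]*d⇒m/d≡q {{m^n≢0 2 z}} z<s (^-monoʳ-< 2 (s≤s (s≤s z≤n)) t<z)

carry-once : ∀ {m} t q → m + 1 ≡ 2 ^ t * (1 + 2 * q) → m + (1 + 2 ^ t) ≡ suc q * 2 ^ (t + 1)
carry-once {m} t q m+1≡ = begin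
  m + (1 + 2 ^ t)            ≡⟨ +-assoc m 1 (2 ^ t) ⟨
  m + 1 + 2 ^ t              ≡⟨ cong (_+ 2 ^ t) m+1≡ ⟩
  2 ^ t * (1 + 2 * q) + 2 ^ t ≡⟨ double (2 ^ t) q ⟩
  suc q * (2 ^ t * 2)        ≡⟨ cong (suc q *_) (^-distribˡ-+-* 2 t 1) ⟨
  suc q * 2 ^ (t + 1)        ∎
  where
  open ≡-Reasoning
  double : ∀ a q → a * (1 + 2 * q) + a ≡ suc q * (a * 2)
  double = solve-∀

carry-twice : ∀ {m} t q s q′ → m + 1 ≡ 2 ^ t * (1 + 2 * q) → q + 1 ≡ 2 ^ s * (1 + 2 * q′) →
              m + (1 + 2 ^ t) ≡ suc (2 * q′) * 2 ^ (t + 1 + s)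
carry-twice {m} t q s q′ m+1≡ q+1≡ = begin
  m + (1 + 2 ^ t)                      ≡⟨ carry-once t q m+1≡ ⟩
  suc q * 2 ^ (t + 1)                  ≡⟨ cong (_* 2 ^ (t + 1)) (trans (+-comm 1 q) q+1≡) ⟩
  2 ^ s * (1 + 2 * q′) * 2 ^ (t + 1)   ≡⟨ regroup (2 ^ s) (1 + 2 * q′) (2 ^ (t + 1)) ⟩
  (1 + 2 * q′) * (2 ^ (t + 1) * 2 ^ s) ≡⟨ cong ((1 + 2 * q′) *_) (^-distribˡ-+-* 2 (t + 1) s) ⟨
  suc (2 * q′) * 2 ^ (t + 1 + s)       ∎
  where
  open ≡-Reasoning
  regroup : ∀ a b c → a * b * c ≡ b * (c * a)
  regroup = solve-∀

m<m+1+n : ∀ m n → m < m + 1 + n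
m<m+1+n m n = ≤-trans (m<m+n m z<s) (m≤m+n (m + 1) n)

-- m = (q′ 0 1ˢ 0 1ᵗ)₂: the two lowest zero bits of m sit at positions t and t + 1 + s.
record LowestTwoZeros (m : ℕ) : Set where
  field
    t q s q′ : ℕ
    m+1≡ : m + 1 ≡ 2 ^ t * (1 + 2 * q)
    q+1≡ : q + 1 ≡ 2 ^ s * (1 + 2 * q′)
    P₂≡  : P₂ m ≡ 2 ^ (t + 1 + s) * (2 * q′) ∸ 1

lowestTwoZeros : ∀ m → LowestTwoZeros m
lowestTwoZeros m = record
  { t = t ; q = q ; s = s ; q′ = q′ ; m+1≡ = m+1≡ ; q+1≡ = q+1≡
  ; P₂≡ = cong (λ x → 2 ^ (t + 1 + s) * x ∸ 1)
               (m+1+2^t≡[1+q]*2^z⇒m/2^z≡q t (t + 1 + s) (2 * q′) (m<m+1+n t s)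
                                          (carry-twice t q s q′ m+1≡ q+1≡))
  }
  where
  t = trailingOnes m m
  lowest = trailingOnes-spec m m ≤-refl
  q = proj₁ lowest
  m+1≡ = proj₂ lowest
  h = (m / 2 ^ (t + 1)) {{m^n≢0 2 (t + 1)}}
  h≡q : h ≡ q
  h≡q = m+1+2^t≡[1+q]*2^z⇒m/2^z≡q t (t + 1) q (m<m+n t z<s) (carry-once t q m+1≡)
  s = trailingOnes m h
  next = trailingOnes-spec m h (m/n≤m m _ {{m^n≢0 2 (t + 1)}})
  q′ = proj₁ next
  q+1≡ : q + 1 ≡ 2 ^ s * (1 + 2 * q′)
  q+1≡ = subst (λ x → x + 1 ≡ 2 ^ s * (1 + 2 * q′)) h≡q (proj₂ next)

P₂≡0⇒m+1+2^t≡2^z : ∀ m → P₂ m ≡ 0 → ∃₂ λ t z → t < z × suc m + 2 ^ t ≡ 2 ^ z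
P₂≡0⇒m+1+2^t≡2^z m P₂m≡0 with lowestTwoZeros m
... | record { t = t ; q = q ; s = s ; q′ = zero ; m+1≡ = m+1≡ ; q+1≡ = q+1≡ } =
  t , t + 1 + s , m<m+1+n t s ,
  trans (sym (+-suc m (2 ^ t))) (trans (carry-twice t q s 0 m+1≡ q+1≡) (*-identityˡ _))
... | record { t = t ; s = s ; q′ = suc x ; P₂≡ = P₂≡ } =
  contradiction (trans (sym P₂≡) P₂m≡0) (>⇒≢ (m<n⇒0<n∸m 1<2ᶻ*[2*[1+x]]))
  where
  1<2ᶻ*[2*[1+x]] : 1 < 2 ^ (t + 1 + s) * (2 * suc x)
  1<2ᶻ*[2*[1+x]] = m≤n⇒m≤o*n (2 ^ (t + 1 + s)) {{m^n≢0 2 (t + 1 + s)}} (*-monoʳ-≤ 2 (s≤s z≤n))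

P₂[2^n∸1]≡0 : ∀ n → P₂ (2 ^ n ∸ 1) ≡ 0
P₂[2^n∸1]≡0 n = begin
  P₂ (2 ^ n ∸ 1)                  ≡⟨ P₂≡ ⟩
  2 ^ (t + 1 + s) * (2 * q′) ∸ 1  ≡⟨ cong (λ x → 2 ^ (t + 1 + s) * (2 * x) ∸ 1) q′≡0 ⟩
  2 ^ (t + 1 + s) * 0 ∸ 1         ≡⟨ cong (_∸ 1) (*-zeroʳ (2 ^ (t + 1 + s))) ⟩
  0                               ∎
  where
  open ≡-Reasoning
  open LowestTwoZeros (lowestTwoZeros (2 ^ n ∸ 1))
  q≡0 : q ≡ 0
  q≡0 = 2^m≡2^n*[1+2q]⇒q≡0 n t q (trans (sym (m∸n+n≡m (m^n>0 2 n))) m+1≡)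
  q′≡0 : q′ ≡ 0
  q′≡0 = 2^m≡2^n*[1+2q]⇒q≡0 0 s q′ (trans (cong (_+ 1) (sym q≡0)) q+1≡)

X+2^t≡2^z∧2^[1+n]≤X<3*2^n⇒X≡2^[1+n] : ∀ n {X t z} → t < z → X + 2 ^ t ≡ 2 ^ z →
                                       2 ^ suc n ≤ X → X < 3 * 2 ^ n → X ≡ 2 ^ suc n
X+2^t≡2^z∧2^[1+n]≤X<3*2^n⇒X≡2^[1+n] n {X} {t} {z} t<z X+2ᵗ≡2ᶻ 2ⁿ⁺¹≤X X<3*2ⁿ =
  +-cancelʳ-≡ (2 ^ suc n) X (2 ^ suc n) (begin-equality
    X + 2 ^ suc n          ≡⟨ cong (λ w → X + 2 ^ w) t≡1+n ⟨
    X + 2 ^ t              ≡⟨ X+2ᵗ≡2ᶻ ⟩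
    2 ^ z                  ≡⟨ cong (2 ^_) z≡2+n ⟩
    2 ^ suc (suc n)        ≡⟨ cong (2 ^ suc n +_) (+-identityʳ (2 ^ suc n)) ⟩
    2 ^ suc n + 2 ^ suc n  ∎)
  where
  open ≤-Reasoning
  c = 2 ^ n
  2ᵗ≤X : 2 ^ t ≤ X
  2ᵗ≤X = +-cancelʳ-≤ (2 ^ t) (2 ^ t) X (begin
    2 ^ t + 2 ^ t  ≡⟨ cong (2 ^ t +_) (+-identityʳ (2 ^ t)) ⟨
    2 ^ suc t      ≤⟨ ^-monoʳ-≤ 2 t<z ⟩
    2 ^ z          ≡⟨ X+2ᵗ≡2ᶻ ⟨
    X + 2 ^ t      ∎)
  1+n<z : suc n < z
  1+n<z = ^-cancelʳ-< 2 (≤-<-trans 2ⁿ⁺¹≤X (subst (X <_) X+2ᵗ≡2ᶻ (m<m+n X (m^n>0 2 t))))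
  z<3+n : z < suc (suc (suc n))
  z<3+n = ^-cancelʳ-< 2 (begin-strict
    2 ^ z                 ≡⟨ X+2ᵗ≡2ᶻ ⟨
    X + 2 ^ t             ≤⟨ +-monoʳ-≤ X 2ᵗ≤X ⟩
    X + X                 <⟨ +-mono-< X<3*2ⁿ X<3*2ⁿ ⟩
    3 * c + 3 * c         ≤⟨ m≤m+n (3 * c + 3 * c) (2 * c) ⟩
    3 * c + 3 * c + 2 * c ≡⟨ eight c ⟩
    2 * (2 * (2 * c))     ∎)
    where
    eight : ∀ c → 3 * c + 3 * c + 2 * c ≡ 2 * (2 * (2 * c))
    eight = solve-∀
  z≡2+n : z ≡ suc (suc n)
  z≡2+n = ≤-antisym (s≤s⁻¹ z<3+n) 1+n<z
  n<t : n < t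
  n<t = ^-cancelʳ-< 2 (+-cancelˡ-< X c (2 ^ t) (begin-strict
    X + c             <⟨ +-monoˡ-< c X<3*2ⁿ ⟩
    3 * c + c         ≡⟨ four c ⟩
    2 * (2 * c)       ≡⟨ cong (2 ^_) z≡2+n ⟨
    2 ^ z             ≡⟨ X+2ᵗ≡2ᶻ ⟨
    X + 2 ^ t         ∎))
    where
    four : ∀ c → 3 * c + c ≡ 2 * (2 * c)
    four = solve-∀
  t≡1+n : t ≡ suc n
  t≡1+n = ≤-antisym (s≤s⁻¹ (subst (t <_) z≡2+n t<z)) n<t

-- IVᵦ k = 2ᵏ⁻¹ ∸ 1 is also the lower bound in the constructors of Edge: the least nonzero node.
edge-from-<IVᵦ-is-red : ∀ {k a b} → Edge k a b → a < IVᵦ k → a ≡ P₂ b × IVᵦ k ≤ b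
edge-from-<IVᵦ-is-red (blue m IVᵦ≤m _) m<IVᵦ = contradiction IVᵦ≤m (<⇒≱ m<IVᵦ)
edge-from-<IVᵦ-is-red (red m IVᵦ≤m _)  _     = refl , IVᵦ≤m

red-edge-unique : ∀ {k m a} (IVᵦ≤m : IVᵦ k ≤ m) (m<2ᵏ∸1 : m < 2 ^ k ∸ 1) (e : Edge k a m) →
                  a < IVᵦ k → (P₂m≡a : P₂ m ≡ a) →
                  subst (λ x → Edge k x m) P₂m≡a (red m IVᵦ≤m m<2ᵏ∸1) ≡ e
red-edge-unique _ _ (blue m IVᵦ≤m _) m<IVᵦ _ = contradiction IVᵦ≤m (<⇒≱ m<IVᵦ)
red-edge-unique IVᵦ≤m m<2ᵏ∸1 (red m IVᵦ≤m′ m<2ᵏ∸1′) _ P₂m≡P₂m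
  rewrite ≡-irrelevant P₂m≡P₂m refl | ≤-irrelevant IVᵦ≤m IVᵦ≤m′ | <-irrelevant m<2ᵏ∸1 m<2ᵏ∸1′ = refl

edges-from-<IVᵦ-unique : ∀ {k a b} (e e′ : Edge k a b) → a < IVᵦ k → e ≡ e′
edges-from-<IVᵦ-unique (blue m IVᵦ≤m _) _ m<IVᵦ = contradiction IVᵦ≤m (<⇒≱ m<IVᵦ)
edges-from-<IVᵦ-unique (red m IVᵦ≤m m<2ᵏ∸1) e′ P₂m<IVᵦ = red-edge-unique IVᵦ≤m m<2ᵏ∸1 e′ P₂m<IVᵦ refl

0<IVᵦ : ∀ n → 0 < IVᵦ (suc (suc n))
0<IVᵦ n = m<n⇒0<n∸m (*-monoʳ-≤ 2 (m^n>0 2 n))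

IVᵦ<2^[1+n]∸1 : ∀ n → IVᵦ (suc n) < 2 ^ suc n ∸ 1
IVᵦ<2^[1+n]∸1 n = ∸-monoˡ-< (^-monoʳ-< 2 (s≤s (s≤s z≤n)) (n<1+n n)) (m^n>0 2 n)

IVᵦ<IIIᵦ : ∀ j → IVᵦ (4 + j) < IIIᵦ (4 + j)
IVᵦ<IIIᵦ j = begin-strict
  2 * (2 * d) ∸ 1                    <⟨ ∸-monoˡ-< (m<m+n (2 * (2 * d)) (m^n>0 2 (suc j)))
                                                   (m^n>0 2 (3 + j)) ⟩
  2 * (2 * d) + d ∸ 1                ≡⟨ cong (_∸ 1) 8d∸2d∸d≡4d+d ⟨
  2 * (2 * (2 * d)) ∸ 2 * d ∸ d ∸ 1  ∎
  where
  open ≤-Reasoning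
  d = 2 ^ suc j
  split : ∀ d → 2 * (2 * (2 * d)) ≡ 2 * (2 * d) + d + d + 2 * d
  split = solve-∀
  8d∸2d∸d≡4d+d : 2 * (2 * (2 * d)) ∸ 2 * d ∸ d ≡ 2 * (2 * d) + d
  8d∸2d∸d≡4d+d = begin-equality
    2 * (2 * (2 * d)) ∸ 2 * d ∸ d          ≡⟨ cong (λ x → x ∸ 2 * d ∸ d) (split d) ⟩
    2 * (2 * d) + d + d + 2 * d ∸ 2 * d ∸ d ≡⟨ cong (_∸ d) (m+n∸n≡m _ (2 * d)) ⟩
    2 * (2 * d) + d + d ∸ d                 ≡⟨ m+n∸n≡m _ d ⟩
    2 * (2 * d) + d                         ∎

IVₜ≤IIₜ : ∀ k → IVₜ k ≤ IIₜ k
IVₜ≤IIₜ k = ∸-monoˡ-≤ 2 (m∸n≤m (2 ^ k ∸ 2 ^ (k ∸ 2)) (2 ^ (k ∸ 3)))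

IVᵦ≤m⇒2^[1+n]≤1+m : ∀ n {m} → IVᵦ (suc (suc n)) ≤ m → 2 ^ suc n ≤ suc m
IVᵦ≤m⇒2^[1+n]≤1+m n IVᵦ≤m = ≤-trans (m≤n+m∸n (2 ^ suc n) 1) (s≤s IVᵦ≤m)

m≤IIₜ⇒1+m<3*2^n : ∀ n {m} → m ≤ IIₜ (suc (suc n)) → suc m < 3 * 2 ^ n
m≤IIₜ⇒1+m<3*2^n n {m} m≤IIₜ = subst (_≤ 3 * c) (+-comm m 2) (m≤o∸n⇒m+n≤o m 2≤3c m≤3c∸2)
  where
  c = 2 ^ n
  split : ∀ c → 2 * (2 * c) ≡ 3 * c + c
  split = solve-∀
  m≤3c∸2 : m ≤ 3 * c ∸ 2
  m≤3c∸2 = subst (λ x → m ≤ x ∸ 2) (trans (cong (_∸ c) (split c)) (m+n∸n≡m (3 * c) c)) m≤IIₜ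
  2≤3c : 2 ≤ 3 * c
  2≤3c = ≤-trans (s≤s (s≤s z≤n)) (*-monoʳ-≤ 3 (m^n>0 2 n))

edge-from-0-below-IIₜ⇒IVᵦ : ∀ n {m} → Edge (suc (suc n)) 0 m → m ≤ IIₜ (suc (suc n)) →
                            m ≡ IVᵦ (suc (suc n))
edge-from-0-below-IIₜ⇒IVᵦ n {m} e m≤IIₜ with edge-from-<IVᵦ-is-red e (0<IVᵦ n)
... | 0≡P₂m , IVᵦ≤m with P₂≡0⇒m+1+2^t≡2^z m (sym 0≡P₂m)
... | t , z , t<z , 1+m+2ᵗ≡2ᶻ = cong (_∸ 1)
  (X+2^t≡2^z∧2^[1+n]≤X<3*2^n⇒X≡2^[1+n] n t<z 1+m+2ᵗ≡2ᶻ
    (IVᵦ≤m⇒2^[1+n]≤1+m n IVᵦ≤m) (m≤IIₜ⇒1+m<3*2^n n m≤IIₜ))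

mainTheorem16 : (k : ℕ) → 4 ≤ k →
    ((m : ℕ) → IIIᵦ k ≤ m → m ≤ IIₜ k → ¬ Edge k 0 m)
    × Edge k 0 (IVᵦ k)
    × ((m : ℕ) → Edge k 0 m → IVᵦ k ≤ m → m ≤ IVₜ k → m ≡ IVᵦ k)
    × ((e e′ : Edge k 0 (IVᵦ k)) → e ≡ e′)
mainTheorem16 _ (s≤s (s≤s (s≤s (s≤s {n = j} _)))) =
    (λ m IIIᵦ≤m m≤IIₜ e →
       <⇒≱ (IVᵦ<IIIᵦ j) (subst (IIIᵦ k ≤_) (edge-from-0-below-IIₜ⇒IVᵦ n e m≤IIₜ) IIIᵦ≤m))
  , subst (λ a → Edge k a (IVᵦ k)) (P₂[2^n∸1]≡0 (suc n)) (red (IVᵦ k) ≤-refl (IVᵦ<2^[1+n]∸1 (suc n)))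
  , (λ m e _ m≤IVₜ → edge-from-0-below-IIₜ⇒IVᵦ n e (≤-trans m≤IVₜ (IVₜ≤IIₜ k)))
  , (λ e e′ → edges-from-<IVᵦ-unique e e′ (0<IVᵦ n))
  where
  n = suc (suc j)
  k = suc (suc n)
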